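{- Let $T=T[A,B]$ be a tree with $a=|A|\le|B|$ and let $T_o$ be any odd-ballooning of $T$. Then $\mathcal{B}(T_o)=\{K_a\}$ if and only if $\beta(T)=a$. Furthermore, if $\delta(A)\ge 2$, then $\beta(T)=a$.
   Context: Graphs are finite and simple. $\beta(G)$ is the minimum number of vertices in a covering of $G$ (a set of vertices meeting all edges). $T=T[A,B]$ denotes a tree with its unique bipartition $A,B$; $\delta(A)=\min\{d_T(v):v\in A\}$. Odd-ballooning: $T_o$ is obtained from $T$ by replacing each edge $uv$ of $T$ by an odd cycle containing $uv$, all new vertices of the cycles being distinct. Decomposition family: $\mathcal{M}(T_o)$ is the set of minimal graphs $M$ such that embedding $M$ into one partite set of the balanced complete bipartite graph $T_2(n)$ (for $n$ large) yields a graph containing $T_o$ as a subgraph. $\mathcal{B}(T_o)$: if no $M\in\mathcal{M}(T_o)$ has a covering with fewer than $a$ vertices, then $\mathcal{B}(T_o)=\{K_a\}$; otherwise $\mathcal{B}(T_o)=\{M[S]: M\in\mathcal{M}(T_o),\ S \text{ a covering of } M,\ |S|<a\}$, with $M[S]$ the induced subgraph. -}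

module Defs where

open import Data.Nat using (ℕ; zero; suc; _+_; _*_; _≤_; _<_)
open import Data.Bool using (Bool; true; false; not)
open import Data.Fin using (Fin; toℕ; inject₁; fromℕ; splitAt) renaming (zero to fzero; suc to fsuc; _<_ to _<ᶠ_)
open import Data.Fin.Properties using (_≟_)
open import Data.Fin.Subset using (Subset; _∈_; ∣_∣)
open import Data.Vec using (Vec; lookup; tabulate)
open import Data.Product using (Σ; ∃; _×_; _,_; proj₁; proj₂)
open import Data.Sum using (_⊎_; inj₁; inj₂)
open import Data.Empty using (⊥; ⊥-elim)
open import Data.Unit using (⊤)
open import Relation.Nullary using (¬_; yes; no)
open import Relation.Nullary.Decidable using (⌊_⌋)
open import Relation.Binary.PropositionalEquality using (_≡_; _≢_; refl; sym)
open import Function.Bundles using (_⇔_)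
open import Function.Definitions using (Injective)

record Graph : Set where
  field
    n      : ℕ
    adj    : Fin n → Fin n → Bool
    adj-sym    : ∀ i j → adj i j ≡ adj j i
    adj-irrefl : ∀ i → adj i i ≡ false
open Graph public

record RGraph : Set₁ where
  constructor rgraph
  field
    V : Set
    E : V → V → Set
open RGraph public

toR : Graph → RGraph
toR G = rgraph (Fin (n G)) (λ i j → adj G i j ≡ true)

_⊆ᴳ_ : RGraph → RGraph → Set
H ⊆ᴳ G = Σ (V H → V G) λ f → Injective _≡_ _≡_ f × (∀ x y → E H x y → E G (f x) (f y))

_≅_ : RGraph → RGraph → Set
H ≅ G = Σ (V H → V G) λ f → Σ (V G → V H) λ g →
          (∀ x → g (f x) ≡ x) × (∀ y → f (g y) ≡ y) × (∀ x y → E H x y ⇔ E G (f x) (f y))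

K : ℕ → Graph
K a = record { n = a ; adj = λ i j → not ⌊ i ≟ j ⌋ ; adj-sym = symK ; adj-irrefl = irrK }
  where
  symK : ∀ (i j : Fin a) → not ⌊ i ≟ j ⌋ ≡ not ⌊ j ≟ i ⌋
  symK i j with i ≟ j | j ≟ i
  ... | yes _ | yes _ = refl
  ... | no _  | no _  = refl
  ... | yes p | no q  = ⊥-elim (q (sym p))
  ... | no p  | yes q = ⊥-elim (p (sym q))
  irrK : ∀ (i : Fin a) → not ⌊ i ≟ i ⌋ ≡ false
  irrK i with i ≟ i
  ... | yes _ = refl
  ... | no p  = ⊥-elim (p refl)

induced : (M : Graph) → Subset (n M) → RGraph
induced M S = rgraph (Σ (Fin (n M)) (λ i → i ∈ S)) (λ x y → adj M (proj₁ x) (proj₁ y) ≡ true)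

Covering : (G : Graph) → Subset (n G) → Set
Covering G S = ∀ i j → adj G i j ≡ true → i ∈ S ⊎ j ∈ S

CoveringNumber : Graph → ℕ → Set
CoveringNumber G k = (Σ (Subset (n G)) λ S → Covering G S × ∣ S ∣ ≡ k)
                   × (∀ S → Covering G S → k ≤ ∣ S ∣)

data Walk (G : Graph) : Fin (n G) → Fin (n G) → Set where
  here : ∀ {i} → Walk G i i
  step : ∀ {i j k} → adj G i j ≡ true → Walk G j k → Walk G i k

Connected : Graph → Set
Connected G = ∀ i j → Walk G i j

-- a cycle c 0, c 1, ..., c k (k ≥ 2, i.e. length ≥ 3) of distinct vertices
HasCycle : Graph → Set
HasCycle G = Σ ℕ λ k → 2 ≤ k × Σ (Fin (suc k) → Fin (n G)) λ c →
  Injective _≡_ _≡_ c × (∀ (i : Fin k) → adj G (c (inject₁ i)) (c (fsuc i)) ≡ true)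
  × adj G (c (fromℕ k)) (c fzero) ≡ true

IsTree : Graph → Set
IsTree G = 1 ≤ n G × Connected G × ¬ HasCycle G

-- A (as a subset) together with its complement B is a proper 2-colouring
IsBipartition : (G : Graph) → Subset (n G) → Set
IsBipartition G A = ∀ i j → adj G i j ≡ true → lookup A i ≢ lookup A j

degree : (G : Graph) → Fin (n G) → ℕ
degree G v = ∣ tabulate (adj G v) ∣

MinDegAtLeast : (G : Graph) → Subset (n G) → ℕ → Set
MinDegAtLeast G A k = ∀ v → v ∈ A → k ≤ degree G v

Edge : Graph → Set
Edge T = Σ (Fin (n T) × Fin (n T)) λ p → proj₁ p <ᶠ proj₂ p × adj T (proj₁ p) (proj₂ p) ≡ true

-- ℓ e determines the cycle replacing e = uv: u, w_0, ..., w_{2ℓ e}, v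
-- of length 2 ℓ e + 3 (all odd lengths ≥ 3 occur).
BVert : (T : Graph) → (Edge T → ℕ) → Set
BVert T ℓ = Fin (n T) ⊎ Σ (Edge T) (λ e → Fin (suc (2 * ℓ e)))

private
  BRel : (T : Graph) (ℓ : Edge T → ℕ) → BVert T ℓ → BVert T ℓ → Set
  BRel T ℓ (inj₁ x) (inj₁ y) = adj T x y ≡ true
  BRel T ℓ (inj₁ x) (inj₂ (e , i)) = x ≡ proj₁ (proj₁ e) × toℕ i ≡ 0
  BRel T ℓ (inj₂ (e , i)) (inj₂ (e' , j)) = e ≡ e' × suc (toℕ i) ≡ toℕ j
  BRel T ℓ (inj₂ (e , i)) (inj₁ y) = y ≡ proj₂ (proj₁ e) × toℕ i ≡ 2 * ℓ e

Balloon : (T : Graph) → (Edge T → ℕ) → RGraph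
Balloon T ℓ = rgraph (BVert T ℓ) (λ x y → BRel T ℓ x y ⊎ BRel T ℓ y x)

-- balanced complete bipartite graph with parts Fin (k + m), Fin (k + m),
-- with M (on Fin k) embedded in the first k vertices of the first part
private
  EmbRel : (M : Graph) (m : ℕ) → Fin (n M + m) ⊎ Fin (n M + m) → Fin (n M + m) ⊎ Fin (n M + m) → Set
  EmbRel M m (inj₁ x) (inj₂ y) = ⊤
  EmbRel M m (inj₂ x) (inj₁ y) = ⊤
  EmbRel M m (inj₂ x) (inj₂ y) = ⊥
  EmbRel M m (inj₁ x) (inj₁ y) with splitAt (n M) x | splitAt (n M) y
  ... | inj₁ i | inj₁ j = adj M i j ≡ true
  ... | _      | _      = ⊥

Emb : Graph → ℕ → RGraph
Emb M m = rgraph (Fin (n M + m) ⊎ Fin (n M + m)) (EmbRel M m)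

-- embedding M into one part of T_2(n) yields a graph containing H, for all large n
Forces : RGraph → Graph → Set
Forces H M = Σ ℕ λ N → ∀ m → N ≤ m → H ⊆ᴳ Emb M m

InDecomp : RGraph → Graph → Set
InDecomp H M = Forces H M × (∀ M' → toR M' ⊆ᴳ toR M → ¬ (toR M ⊆ᴳ toR M') → ¬ Forces H M')

HasSmallCover : RGraph → ℕ → Set
HasSmallCover H a = Σ Graph λ M → InDecomp H M × Σ (Subset (n M)) λ S → Covering M S × ∣ S ∣ < a

InB : RGraph → ℕ → Graph → Set
InB H a G = (¬ HasSmallCover H a × toR G ≅ toR (K a))
          ⊎ (Σ Graph λ M → InDecomp H M × Σ (Subset (n M)) λ S →
               Covering M S × ∣ S ∣ < a × toR G ≅ induced M S)

BIsKa : RGraph → ℕ → Set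
BIsKa H a = ∀ G → InB H a G ⇔ (toR G ≅ toR (K a))

{-# OPTIONS --safe #-}
-- If S covers a member M of the decomposition family, then in a copy of T_o inside T_2(n) with M
-- embedded in one part, every odd cycle meets the copy of S, because the rest of the host graph is
-- bipartite; charging each hit to the tree vertex owning the cycle vertex gives a covering of T by
-- at most |S| vertices. So β(T) = a excludes coverings of size < a and 𝓑(T_o) = {K_a}. Conversely,
-- T itself forces T_o, hence contains a minimal forcing graph M, and a covering of T with fewer than
-- a vertices restricts to one of M. If δ(A) ≥ 2, root T anywhere: every x ∈ A has a child and no two
-- vertices share a child, so sending x to itself when x ∈ S and to a child otherwise injects A into
-- any covering S.
module Submission where

open import Defs
open import Data.Nat using (ℕ; _≤_)
open import Data.Fin.Subset using (Subset; ∁; ∣_∣)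
open import Data.Product using (_×_)
open import Function.Bundles using (_⇔_)

open import Data.Nat using (zero; suc; _+_; _*_; _<_; _⊔_; z≤n; s≤s; parity)
import Data.Nat.Properties as ℕ
open import Data.Nat.Induction using (<-wellFounded; Acc; acc)
open import Data.Bool using (Bool; true; false)
open import Data.Bool.Properties using () renaming (_≟_ to _≟ᵇ_)
open import Data.Fin as Fin using (Fin; toℕ) renaming (zero to fzero; suc to fsuc)
import Data.Fin.Properties as Fin
open import Data.Fin.Subset using (_∈_; inside; outside)
open import Data.Fin.Subset.Properties using (_∈?_)
open import Data.Parity using (Parity; 0ℙ; 1ℙ; _⁻¹) renaming (_+_ to _+ℙ_)
import Data.Parity.Properties as ℙ
open import Data.Vec using (_∷_; here; there; lookup; tabulate)
open import Data.Vec.Properties using (lookup∘tabulate; []=⇒lookup; lookup⇒[]=)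
open import Data.Vec.Properties.WithK using ([]=-irrelevant)
open import Data.Product using (Σ; ∃; _,_; proj₁; proj₂)
open import Data.Sum using (_⊎_; inj₁; inj₂)
import Data.Sum.Properties as Sum
open import Data.Empty using (⊥; ⊥-elim)
open import Data.Unit using (tt)
open import Relation.Nullary using (¬_; Dec; yes; no; does; contradiction)
open import Relation.Nullary.Decidable using (_×-dec_; _⊎-dec_; map′)
open import Relation.Binary.Definitions using (tri<; tri≈; tri>)
open import Axiom.UniquenessOfIdentityProofs.WithK using (uip)
open import Relation.Binary.PropositionalEquality
  using (_≡_; _≢_; refl; sym; trans; cong; cong₂; subst; module ≡-Reasoning)
open import Function.Base using (id; _∘_)
open import Function.Bundles using (mk⇔; Equivalence)
open import Function.Definitions using (Injective)

private
  variable
    k m : ℕ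

index : (p : Subset m) {x : Fin m} → x ∈ p → Fin ∣ p ∣
index (inside ∷ p) here = fzero
index (inside ∷ p) (there x∈p) = fsuc (index p x∈p)
index (outside ∷ p) (there x∈p) = index p x∈p

index-injective : (p : Subset m) {x y : Fin m} (x∈p : x ∈ p) (y∈p : y ∈ p)
                → index p x∈p ≡ index p y∈p → x ≡ y
index-injective (inside ∷ p) here here _ = refl
index-injective (inside ∷ p) (there x∈p) (there y∈p) eq =
  cong fsuc (index-injective p x∈p y∈p (Fin.suc-injective eq))
index-injective (outside ∷ p) (there x∈p) (there y∈p) eq =
  cong fsuc (index-injective p x∈p y∈p eq)

element : (p : Subset m) → Fin ∣ p ∣ → Fin m
element (inside ∷ p) fzero = fzero
element (inside ∷ p) (fsuc i) = fsuc (element p i)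
element (outside ∷ p) i = fsuc (element p i)

element-∈ : (p : Subset m) (i : Fin ∣ p ∣) → element p i ∈ p
element-∈ (inside ∷ p) fzero = here
element-∈ (inside ∷ p) (fsuc i) = there (element-∈ p i)
element-∈ (outside ∷ p) i = there (element-∈ p i)

element-injective : (p : Subset m) → Injective _≡_ _≡_ (element p)
element-injective (inside ∷ p) {fzero} {fzero} _ = refl
element-injective (inside ∷ p) {fsuc i} {fsuc j} eq =
  cong fsuc (element-injective p (Fin.suc-injective eq))
element-injective (outside ∷ p) eq = element-injective p (Fin.suc-injective eq)

injective-nonSurjective⇒< : (f : Fin m → Fin k) → Injective _≡_ _≡_ f
                          → (y : Fin k) → (∀ x → f x ≢ y) → m < k
injective-nonSurjective⇒< {k = suc _} f f-inj y y∉f =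
  s≤s (Fin.injective⇒≤ (λ eq → f-inj (Fin.punchOut-injective y≢f y≢f eq)))
  where
  y≢f : ∀ {x} → y ≢ f x
  y≢f {x} eq = y∉f x (sym eq)

module _ {m k} (p : Subset m) (q : Subset k) (f : ∀ x → x ∈ p → Fin k)
         (f-∈ : ∀ x x∈p → f x x∈p ∈ q)
         (f-injective : ∀ {x y} x∈p y∈p → f x x∈p ≡ f y y∈p → x ≡ y) where

  private
    f̂ : Fin ∣ p ∣ → Fin ∣ q ∣
    f̂ i = index q (f-∈ _ (element-∈ p i))

    f̂-injective : Injective _≡_ _≡_ f̂
    f̂-injective eq = element-injective p (f-injective _ _ (index-injective q _ _ eq))

  injection⇒∣p∣≤∣q∣ : ∣ p ∣ ≤ ∣ q ∣
  injection⇒∣p∣≤∣q∣ = Fin.injective⇒≤ f̂-injective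

  nonSurjective-injection⇒∣p∣<∣q∣ : (y : Fin k) (y∈q : y ∈ q) → (∀ x x∈p → f x x∈p ≢ y)
                                  → ∣ p ∣ < ∣ q ∣
  nonSurjective-injection⇒∣p∣<∣q∣ y y∈q y∉f =
    injective-nonSurjective⇒< f̂ f̂-injective (index q y∈q)
      (λ i eq → y∉f _ _ (index-injective q _ y∈q eq))

∈-tabulate⁺ : (g : Fin m → Bool) {x : Fin m} → g x ≡ true → x ∈ tabulate g
∈-tabulate⁺ g {x} gx = lookup⇒[]= x (tabulate g) (trans (lookup∘tabulate g x) gx)

∈-tabulate⁻ : (g : Fin m → Bool) {x : Fin m} → x ∈ tabulate g → g x ≡ true
∈-tabulate⁻ g {x} x∈ = trans (sym (lookup∘tabulate g x)) ([]=⇒lookup x∈)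

module _ {P : Fin m → Set} (P? : ∀ x → Dec (P x)) where

  subsetOf : Subset m
  subsetOf = tabulate (λ x → does (P? x))

  ∈-subsetOf⁺ : ∀ {x} → P x → x ∈ subsetOf
  ∈-subsetOf⁺ {x} px with P? x | ∈-tabulate⁺ (λ x → does (P? x)) {x}
  ... | yes _ | x∈ = x∈ refl
  ... | no ¬px | _ = contradiction px ¬px

  ∈-subsetOf⁻ : ∀ {x} → x ∈ subsetOf → P x
  ∈-subsetOf⁻ {x} x∈ with P? x | ∈-tabulate⁻ (λ x → does (P? x)) {x} x∈
  ... | yes px | _ = px
  ... | no _ | ()

parity-suc : ∀ t → parity (suc t) ≡ parity t ⁻¹
parity-suc t = sym (ℙ.⁻¹-selfInverse (ℙ.suc-homo-⁻¹ t))

⁻¹-+ : ∀ p q → (p +ℙ q) ⁻¹ ≡ p ⁻¹ +ℙ q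
⁻¹-+ 0ℙ q = refl
⁻¹-+ 1ℙ q = ℙ.⁻¹-involutive q

parity-2* : ∀ t → parity (2 * t) ≡ 0ℙ
parity-2* t = ℙ.*-homo-* 2 t

parity-≢-suc : ∀ t → parity t ≢ parity (suc t)
parity-≢-suc t eq = ℙ.p≢p⁻¹ _ (trans eq (parity-suc t))

≅-refl : (G : RGraph) → G ≅ G
≅-refl G = id , id , (λ _ → refl) , (λ _ → refl) , (λ _ _ → mk⇔ id id)

K≅induced⇒∣S∣≥ : ∀ a (M : Graph) (S : Subset (n M)) → toR (K a) ≅ induced M S → a ≤ ∣ S ∣
K≅induced⇒∣S∣≥ a M S (f , g , g∘f , _) = Fin.injective⇒≤ f̂-injective
  where
  f̂ : Fin a → Fin ∣ S ∣
  f̂ i = index S (proj₂ (f i))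

  f-≡ : ∀ {x y : Σ (Fin (n M)) (_∈ S)} → proj₁ x ≡ proj₁ y → x ≡ y
  f-≡ {x , x∈} {.x , x∈′} refl = cong (x ,_) ([]=-irrelevant x∈ x∈′)

  f̂-injective : Injective _≡_ _≡_ f̂
  f̂-injective {i} {j} eq = begin
    i         ≡⟨ sym (g∘f i) ⟩
    g (f i)   ≡⟨ cong g (f-≡ (index-injective S _ _ eq)) ⟩
    g (f j)   ≡⟨ g∘f j ⟩
    j         ∎
    where open ≡-Reasoning

BIsKa⇔noSmallCover : ∀ (H : RGraph) a → BIsKa H a ⇔ (¬ HasSmallCover H a)
BIsKa⇔noSmallCover H a = mk⇔ to from
  where
  to : BIsKa H a → ¬ HasSmallCover H a
  to B≡K small with Equivalence.from (B≡K (K a)) (≅-refl (toR (K a)))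
  ... | inj₁ (noSmall , _) = noSmall small
  ... | inj₂ (M , _ , S , _ , ∣S∣<a , K≅M[S]) =
    ℕ.<⇒≱ ∣S∣<a (K≅induced⇒∣S∣≥ a M S K≅M[S])

  from : ¬ HasSmallCover H a → BIsKa H a
  from noSmall G = mk⇔ inB⇒≅K (λ G≅K → inj₁ (noSmall , G≅K))
    where
    inB⇒≅K : InB H a G → toR G ≅ toR (K a)
    inB⇒≅K (inj₁ (_ , G≅K)) = G≅K
    inB⇒≅K (inj₂ (M , M∈ , S , S-covers , ∣S∣<a , _)) =
      ⊥-elim (noSmall (M , M∈ , S , S-covers , ∣S∣<a))

bipartition-covers : (G : Graph) (A : Subset (n G)) → IsBipartition G A → Covering G A
bipartition-covers G A bip i j ij with lookup A i in Ai | lookup A j in Aj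
... | true | _ = inj₁ (lookup⇒[]= i A Ai)
... | false | true = inj₂ (lookup⇒[]= j A Aj)
... | false | false = ⊥-elim (bip i j ij (trans Ai (sym Aj)))

module _ (T : Graph) where

  source target : Edge T → Fin (n T)
  source e = proj₁ (proj₁ e)
  target e = proj₂ (proj₁ e)

  Edge-≡ : ∀ {u v} (u<v u<v′ : u Fin.< v) (uv uv′ : adj T u v ≡ true)
         → _≡_ {A = Edge T} ((u , v) , u<v , uv) ((u , v) , u<v′ , uv′)
  Edge-≡ u<v u<v′ uv uv′ rewrite Fin.<-irrelevant u<v u<v′ | uip uv uv′ = refl

  Edge-any? : {P : Edge T → Set} → (∀ e → Dec (P e)) → Dec (Σ (Edge T) P)
  Edge-any? {P} P? =
    map′ (λ (u , v , u<v , uv , p) → ((u , v) , u<v , uv) , p)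
         (λ (((u , v) , u<v , uv) , p) → u , v , u<v , uv , p)
         (Fin.any? λ u → Fin.any? λ v → edge-with-P? u v)
    where
    edge-with-P? : ∀ u v → Dec (Σ (u Fin.< v) λ u<v → Σ (adj T u v ≡ true) λ uv →
                                  P ((u , v) , u<v , uv))
    edge-with-P? u v with u Fin.<? v | adj T u v ≟ᵇ true
    ... | no u≮v | _ = no (λ (u<v , _) → u≮v u<v)
    ... | yes _ | no ¬uv = no (λ (_ , uv , _) → ¬uv uv)
    ... | yes u<v | yes uv =
      map′ (λ p → u<v , uv , p)
           (λ (u<v′ , uv′ , p) → subst P (Edge-≡ u<v′ u<v uv′ uv) p)
           (P? ((u , v) , u<v , uv))

  edgesCovered⇒Covering : (C : Subset (n T)) → (∀ e → source e ∈ C ⊎ target e ∈ C)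
                        → Covering T C
  edgesCovered⇒Covering C covers i j ij with Fin.<-cmp i j
  ... | tri< i<j _ _ = covers ((i , j) , i<j , ij)
  ... | tri≈ _ refl _ = contradiction (trans (sym ij) (adj-irrefl T i)) λ ()
  ... | tri> _ _ j<i with covers ((j , i) , j<i , trans (adj-sym T j i) ij)
  ...   | inj₁ j∈C = inj₂ j∈C
  ...   | inj₂ i∈C = inj₁ i∈C

part : {X : Set} → X ⊎ X → Parity
part (inj₁ _) = 0ℙ
part (inj₂ _) = 1ℙ

place : {X : Set} → Parity → X → X ⊎ X
place 0ℙ = inj₁
place 1ℙ = inj₂

part-place : ∀ {X : Set} p (x : X) → part (place p x) ≡ p
part-place 0ℙ x = refl
part-place 1ℙ x = refl

place-injective : ∀ {X : Set} p q {x y : X} → place p x ≡ place q y → x ≡ y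
place-injective 0ℙ 0ℙ refl = refl
place-injective 1ℙ 1ℙ refl = refl

crossing⇒edge : ∀ (M : Graph) m y y′ → part y ≢ part y′ → E (Emb M m) y y′
crossing⇒edge M m (inj₁ _) (inj₂ _) _ = tt
crossing⇒edge M m (inj₂ _) (inj₁ _) _ = tt
crossing⇒edge M m (inj₁ _) (inj₁ _) ≢ = contradiction refl ≢
crossing⇒edge M m (inj₂ _) (inj₂ _) ≢ = contradiction refl ≢

module CopyOf (M : Graph) (m : ℕ) (S : Subset (n M)) where

  InCopy : V (Emb M m) → Set
  InCopy (inj₁ x) = Σ (Fin (n M)) λ i → Fin.splitAt (n M) x ≡ inj₁ i × i ∈ S
  InCopy (inj₂ _) = ⊥

  inCopy? : ∀ y → Dec (InCopy y)
  inCopy? (inj₂ _) = no λ ()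
  inCopy? (inj₁ x) with Fin.splitAt (n M) x
  ... | inj₂ _ = no λ ()
  ... | inj₁ i with i ∈? S
  ...   | yes i∈S = yes (i , refl , i∈S)
  ...   | no i∉S = no λ { (_ , refl , i∈S) → i∉S i∈S }

  copyIndex : ∀ y → InCopy y → Fin (n M)
  copyIndex (inj₁ _) (i , _) = i

  copyIndex-∈ : ∀ y (y∈ : InCopy y) → copyIndex y y∈ ∈ S
  copyIndex-∈ (inj₁ _) (_ , _ , i∈S) = i∈S

  copyIndex-injective : ∀ {y y′} (y∈ : InCopy y) (y′∈ : InCopy y′)
                      → copyIndex y y∈ ≡ copyIndex y′ y′∈ → y ≡ y′
  copyIndex-injective {inj₁ x} {inj₁ x′} (i , split , _) (.i , split′ , _) refl =
    cong inj₁ (trans (sym (Fin.splitAt⁻¹-↑ˡ split)) (Fin.splitAt⁻¹-↑ˡ split′))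

  edge-inCopy-or-crosses : Covering M S → ∀ y y′ → E (Emb M m) y y′
                         → InCopy y ⊎ InCopy y′ ⊎ part y′ ≡ part y ⁻¹
  edge-inCopy-or-crosses _ (inj₁ _) (inj₂ _) _ = inj₂ (inj₂ refl)
  edge-inCopy-or-crosses _ (inj₂ _) (inj₁ _) _ = inj₂ (inj₂ refl)
  edge-inCopy-or-crosses covers (inj₁ x) (inj₁ x′) xx′ with Fin.splitAt (n M) x | Fin.splitAt (n M) x′
  ... | inj₁ i | inj₁ j with covers i j xx′
  ...   | inj₁ i∈S = inj₁ (i , refl , i∈S)
  ...   | inj₂ j∈S = inj₂ (inj₁ (j , refl , j∈S))

module BalloonInEmb (T : Graph) (ℓ : Edge T → ℕ) (M : Graph) (S : Subset (n M)) (S-covers : Covering M S)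
                    (m : ℕ) (f : BVert T ℓ → V (Emb M m)) (f-injective : Injective _≡_ _≡_ f)
                    (f-edge : ∀ x y → E (Balloon T ℓ) x y → E (Emb M m) (f x) (f y)) where

  open CopyOf M m S

  CycleHit : Edge T → Set
  CycleHit e = InCopy (f (inj₁ (source T e))) ⊎ InCopy (f (inj₁ (target T e)))
             ⊎ Σ (Fin (suc (2 * ℓ e))) λ i → InCopy (f (inj₂ (e , i)))

  cycleHit? : ∀ e → Dec (CycleHit e)
  cycleHit? e = inCopy? _ ⊎-dec inCopy? _ ⊎-dec Fin.any? λ i → inCopy? (f (inj₂ (e , i)))

  crosses : ∀ {x y} → ¬ InCopy (f x) → ¬ InCopy (f y) → E (Balloon T ℓ) x y
          → part (f y) ≡ part (f x) ⁻¹
  crosses {x} {y} x∉ y∉ xy with edge-inCopy-or-crosses S-covers (f x) (f y) (f-edge x y xy)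
  ... | inj₁ x∈ = contradiction x∈ x∉
  ... | inj₂ (inj₁ y∈) = contradiction y∈ y∉
  ... | inj₂ (inj₂ flip) = flip

  module CycleAvoidingCopy (e : Edge T) (miss : ¬ CycleHit e) where

    u v : Fin (n T)
    u = source T e
    v = target T e

    s : Parity
    s = part (f (inj₁ u))

    w : ∀ t → t < suc (2 * ℓ e) → BVert T ℓ
    w t t< = inj₂ (e , Fin.fromℕ< t<)

    w-step : ∀ t (t< : suc t < suc (2 * ℓ e))
           → E (Balloon T ℓ) (w t (ℕ.<-trans (ℕ.n<1+n t) t<)) (w (suc t) t<)
    w-step t t< = inj₁ (refl , trans (cong suc (Fin.toℕ-fromℕ< _)) (sym (Fin.toℕ-fromℕ< t<)))

    u∉ : ¬ InCopy (f (inj₁ u))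
    u∉ u∈ = miss (inj₁ u∈)

    v∉ : ¬ InCopy (f (inj₁ v))
    v∉ v∈ = miss (inj₂ (inj₁ v∈))

    w∉ : ∀ t t< → ¬ InCopy (f (w t t<))
    w∉ t t< w∈ = miss (inj₂ (inj₂ (_ , w∈)))

    part-w : ∀ t (t< : t < suc (2 * ℓ e)) → part (f (w t t<)) ≡ parity (suc t) +ℙ s
    part-w zero t< = crosses u∉ (w∉ 0 t<) (inj₁ (refl , Fin.toℕ-fromℕ< t<))
    part-w (suc t) t< = begin
      part (f (w (suc t) t<))   ≡⟨ crosses (w∉ t t<′) (w∉ (suc t) t<) (w-step t t<) ⟩
      part (f (w t t<′)) ⁻¹     ≡⟨ cong _⁻¹ (part-w t t<′) ⟩
      (parity (suc t) +ℙ s) ⁻¹  ≡⟨ ⁻¹-+ (parity (suc t)) s ⟩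
      parity (suc t) ⁻¹ +ℙ s    ≡⟨ cong (_+ℙ s) (ℙ.suc-homo-⁻¹ t) ⟩
      parity t +ℙ s             ∎
      where
      open ≡-Reasoning
      t<′ : t < suc (2 * ℓ e)
      t<′ = ℕ.<-trans (ℕ.n<1+n t) t<

    part-v : part (f (inj₁ v)) ≡ s
    part-v = begin
      part (f (inj₁ v))                 ≡⟨ crosses (w∉ _ last<) v∉ w-last ⟩
      part (f (w _ last<)) ⁻¹           ≡⟨ cong _⁻¹ (part-w _ last<) ⟩
      (parity (suc (2 * ℓ e)) +ℙ s) ⁻¹  ≡⟨ ⁻¹-+ (parity (suc (2 * ℓ e))) s ⟩
      parity (suc (2 * ℓ e)) ⁻¹ +ℙ s    ≡⟨ cong (_+ℙ s) (ℙ.suc-homo-⁻¹ (2 * ℓ e)) ⟩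
      parity (2 * ℓ e) +ℙ s             ≡⟨ cong (_+ℙ s) (parity-2* (ℓ e)) ⟩
      s                                 ∎
      where
      open ≡-Reasoning
      last< : 2 * ℓ e < suc (2 * ℓ e)
      last< = ℕ.n<1+n (2 * ℓ e)

      w-last : E (Balloon T ℓ) (w _ last<) (inj₁ v)
      w-last = inj₁ (refl , Fin.toℕ-fromℕ< last<)

    part-v-flipped : part (f (inj₁ v)) ≡ s ⁻¹
    part-v-flipped = crosses u∉ v∉ (inj₁ (proj₂ (proj₂ e)))

  -- An odd cycle has no proper 2-colouring, so its image cannot avoid the copy of S.
  cycleHit : ∀ e → CycleHit e
  cycleHit e with cycleHit? e
  ... | yes hit = hit
  ... | no miss = ⊥-elim (ℙ.p≢p⁻¹ _ (trans (sym part-v) part-v-flipped))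
    where open CycleAvoidingCopy e miss

  owner : BVert T ℓ → Fin (n T)
  owner (inj₁ x) = x
  owner (inj₂ (e , _)) = source T e

  Owns : Fin (n T) → Set
  Owns x = Σ (BVert T ℓ) λ y → owner y ≡ x × InCopy (f y)

  owns? : ∀ x → Dec (Owns x)
  owns? x = map′ to from (inCopy? (f (inj₁ x)) ⊎-dec Edge-any? T edgeOwns?)
    where
    EdgeOwns : Edge T → Set
    EdgeOwns e = source T e ≡ x × Σ (Fin (suc (2 * ℓ e))) λ i → InCopy (f (inj₂ (e , i)))

    edgeOwns? : ∀ e → Dec (EdgeOwns e)
    edgeOwns? e = (source T e Fin.≟ x) ×-dec Fin.any? λ i → inCopy? (f (inj₂ (e , i)))

    to : InCopy (f (inj₁ x)) ⊎ Σ (Edge T) EdgeOwns → Owns x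
    to (inj₁ x∈) = inj₁ x , refl , x∈
    to (inj₂ (e , refl , i , w∈)) = inj₂ (e , i) , refl , w∈

    from : Owns x → InCopy (f (inj₁ x)) ⊎ Σ (Edge T) EdgeOwns
    from (inj₁ _ , refl , x∈) = inj₁ x∈
    from (inj₂ (e , i) , refl , w∈) = inj₂ (e , refl , i , w∈)

  cover : Subset (n T)
  cover = subsetOf owns?

  cover-covers : Covering T cover
  cover-covers = edgesCovered⇒Covering T cover λ e → owned-end e (cycleHit e)
    where
    owned-end : ∀ e → CycleHit e → source T e ∈ cover ⊎ target T e ∈ cover
    owned-end e (inj₁ u∈) = inj₁ (∈-subsetOf⁺ owns? (inj₁ _ , refl , u∈))
    owned-end e (inj₂ (inj₁ v∈)) = inj₂ (∈-subsetOf⁺ owns? (inj₁ _ , refl , v∈))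
    owned-end e (inj₂ (inj₂ (i , w∈))) = inj₁ (∈-subsetOf⁺ owns? (inj₂ (e , i) , refl , w∈))

  ∣cover∣≤∣S∣ : ∣ cover ∣ ≤ ∣ S ∣
  ∣cover∣≤∣S∣ =
    injection⇒∣p∣≤∣q∣ cover S image (λ x x∈ → copyIndex-∈ _ (witness-∈ x x∈)) image-injective
    where
    witness : ∀ x → x ∈ cover → BVert T ℓ
    witness x x∈ = proj₁ (∈-subsetOf⁻ owns? x∈)

    witness-owner : ∀ x x∈ → owner (witness x x∈) ≡ x
    witness-owner x x∈ = proj₁ (proj₂ (∈-subsetOf⁻ owns? x∈))

    witness-∈ : ∀ x x∈ → InCopy (f (witness x x∈))
    witness-∈ x x∈ = proj₂ (proj₂ (∈-subsetOf⁻ owns? x∈))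

    image : ∀ x → x ∈ cover → Fin (n M)
    image x x∈ = copyIndex _ (witness-∈ x x∈)

    image-injective : ∀ {x y} x∈ y∈ → image x x∈ ≡ image y y∈ → x ≡ y
    image-injective {x} {y} x∈ y∈ eq = begin
      x                     ≡⟨ sym (witness-owner x x∈) ⟩
      owner (witness x x∈)  ≡⟨ cong owner (f-injective (copyIndex-injective _ _ eq)) ⟩
      owner (witness y y∈)  ≡⟨ witness-owner y y∈ ⟩
      y                     ∎
      where open ≡-Reasoning

coveringNumber≥⇒noSmallCover : ∀ (T : Graph) (ℓ : Edge T → ℕ) a
                             → (∀ C → Covering T C → a ≤ ∣ C ∣)
                             → ¬ HasSmallCover (Balloon T ℓ) a
coveringNumber≥⇒noSmallCover T ℓ a β≥a (M , ((N , forces) , _) , S , S-covers , ∣S∣<a)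
  with forces N ℕ.≤-refl
... | f , f-injective , f-edge =
  ℕ.<⇒≱ ∣S∣<a (ℕ.≤-trans (β≥a cover cover-covers) ∣cover∣≤∣S∣)
  where open BalloonInEmb T ℓ M S S-covers N f f-injective f-edge

sup : (Fin k → ℕ) → ℕ
sup {zero} g = 0
sup {suc k} g = g fzero ⊔ sup (λ i → g (fsuc i))

≤-sup : (g : Fin k → ℕ) (i : Fin k) → g i ≤ sup g
≤-sup g fzero = ℕ.m≤m⊔n _ _
≤-sup g (fsuc i) = ℕ.≤-trans (≤-sup (λ i → g (fsuc i)) i) (ℕ.m≤n⊔m _ _)

↑ˡ≢↑ʳ : ∀ {k} m (x : Fin k) (j : Fin m) → x Fin.↑ˡ m ≢ k Fin.↑ʳ j
↑ˡ≢↑ʳ {k} m x j eq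
  with trans (sym (Fin.splitAt-↑ˡ k x m)) (trans (cong (Fin.splitAt k) eq) (Fin.splitAt-↑ʳ k m j))
... | ()

module BalloonIntoTreeEmb (T : Graph) (ℓ : Edge T → ℕ) where

  ℓ̂ : Fin (n T) → Fin (n T) → ℕ
  ℓ̂ u v with u Fin.<? v | adj T u v ≟ᵇ true
  ... | yes u<v | yes uv = ℓ ((u , v) , u<v , uv)
  ... | _ | _ = 0

  L : ℕ
  L = sup λ u → sup (ℓ̂ u)

  ℓ≤L : ∀ e → ℓ e ≤ L
  ℓ≤L ((u , v) , u<v , uv) =
    ℕ.≤-trans ℓ≤ℓ̂ (ℕ.≤-trans (≤-sup (ℓ̂ u) v) (≤-sup (λ u → sup (ℓ̂ u)) u))
    where
    ℓ≤ℓ̂ : ℓ ((u , v) , u<v , uv) ≤ ℓ̂ u v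
    ℓ≤ℓ̂ with u Fin.<? v | adj T u v ≟ᵇ true
    ... | yes u<v′ | yes uv′ rewrite Edge-≡ T u<v u<v′ uv uv′ = ℕ.≤-refl
    ... | no u≮v | _ = contradiction u<v u≮v
    ... | yes _ | no ¬uv = contradiction uv ¬uv

  Q : ℕ
  Q = (n T * n T) * suc (2 * L)

  code : (e : Edge T) → Fin (suc (2 * ℓ e)) → Fin Q
  code e i = Fin.combine (Fin.combine (source T e) (target T e))
                         (Fin.inject≤ i (s≤s (ℕ.*-monoʳ-≤ 2 (ℓ≤L e))))

  code-injective : ∀ e e′ i i′ → code e i ≡ code e′ i′
                 → _≡_ {A = Σ (Edge T) λ e → Fin (suc (2 * ℓ e))} (e , i) (e′ , i′)
  code-injective ((u , v) , u<v , uv) ((u′ , v′) , u<v′ , uv′) i i′ eq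
    with Fin.combine-injective (Fin.combine u v) _ (Fin.combine u′ v′) _ eq
  ... | uv≡ , i≡ with Fin.combine-injective u v u′ v′ uv≡
  ...   | refl , refl with Fin.<-irrelevant u<v u<v′ | uip uv uv′
  ...     | refl | refl = cong (_ ,_) (Fin.inject≤-injective _ _ i i′ i≡)

  module _ (m : ℕ) (Q≤m : Q ≤ m) where

    -- The new vertices of a cycle alternate between the parts, starting and ending opposite T.
    embed : BVert T ℓ → V (Emb T m)
    embed (inj₁ x) = inj₁ (x Fin.↑ˡ m)
    embed (inj₂ (e , i)) = place (parity (suc (toℕ i))) (n T Fin.↑ʳ Fin.inject≤ (code e i) Q≤m)

    part-embed : ∀ e i → part (embed (inj₂ (e , i))) ≡ parity (suc (toℕ i))
    part-embed e i = part-place (parity (suc (toℕ i))) _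

    end-part : ∀ e i → toℕ i ≡ 0 ⊎ toℕ i ≡ 2 * ℓ e → part (embed (inj₂ (e , i))) ≡ 1ℙ
    end-part e i (inj₁ i≡0) = trans (part-embed e i) (cong (parity ∘ suc) i≡0)
    end-part e i (inj₂ i≡2ℓ) = begin
      part (embed (inj₂ (e , i)))  ≡⟨ part-embed e i ⟩
      parity (suc (toℕ i))         ≡⟨ cong (parity ∘ suc) i≡2ℓ ⟩
      parity (suc (2 * ℓ e))       ≡⟨ parity-suc (2 * ℓ e) ⟩
      parity (2 * ℓ e) ⁻¹          ≡⟨ cong _⁻¹ (parity-2* (ℓ e)) ⟩
      1ℙ                           ∎
      where open ≡-Reasoning

    next-part : ∀ e i j → suc (toℕ i) ≡ toℕ j
              → part (embed (inj₂ (e , i))) ≢ part (embed (inj₂ (e , j)))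
    next-part e i j i+1≡j eq = parity-≢-suc (suc (toℕ i))
      (trans (sym (part-embed e i)) (trans eq (trans (part-embed e j) (cong (parity ∘ suc) (sym i+1≡j)))))

    tree≢new : ∀ x p j → inj₁ (x Fin.↑ˡ m) ≢ place p (n T Fin.↑ʳ j)
    tree≢new x 0ℙ j eq = ↑ˡ≢↑ʳ m x j (Sum.inj₁-injective eq)
    tree≢new x 1ℙ j ()

    embed-injective : Injective _≡_ _≡_ embed
    embed-injective {inj₁ x} {inj₁ y} eq = cong inj₁ (Fin.↑ˡ-injective m x y (Sum.inj₁-injective eq))
    embed-injective {inj₁ x} {inj₂ _} eq = contradiction eq (tree≢new x _ _)
    embed-injective {inj₂ _} {inj₁ y} eq = contradiction (sym eq) (tree≢new y _ _)
    embed-injective {inj₂ (e , i)} {inj₂ (e′ , i′)} eq =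
      cong inj₂ (code-injective e e′ i i′ (Fin.inject≤-injective Q≤m Q≤m _ _
        (Fin.↑ʳ-injective (n T) _ _ (place-injective _ _ eq))))

    tree-edge : ∀ {x y} → adj T x y ≡ true → E (Emb T m) (embed (inj₁ x)) (embed (inj₁ y))
    tree-edge {x} {y} xy rewrite Fin.splitAt-↑ˡ (n T) x m | Fin.splitAt-↑ˡ (n T) y m = xy

    end-edge : ∀ x e i → toℕ i ≡ 0 ⊎ toℕ i ≡ 2 * ℓ e
             → part (embed (inj₁ x)) ≢ part (embed (inj₂ (e , i)))
    end-edge x e i end eq = ℙ.p≢p⁻¹ 0ℙ (trans eq (end-part e i end))

    embed-edge : ∀ x y → E (Balloon T ℓ) x y → E (Emb T m) (embed x) (embed y)
    embed-edge (inj₁ x) (inj₁ y) (inj₁ xy) = tree-edge xy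
    embed-edge (inj₁ x) (inj₁ y) (inj₂ yx) = tree-edge (trans (adj-sym T x y) yx)
    embed-edge (inj₁ x) (inj₂ (e , i)) (inj₁ (_ , i≡0)) =
      crossing⇒edge T m _ _ (end-edge x e i (inj₁ i≡0))
    embed-edge (inj₁ x) (inj₂ (e , i)) (inj₂ (_ , i≡2ℓ)) =
      crossing⇒edge T m _ _ (end-edge x e i (inj₂ i≡2ℓ))
    embed-edge (inj₂ (e , i)) (inj₁ x) (inj₁ (_ , i≡2ℓ)) =
      crossing⇒edge T m _ _ (λ eq → end-edge x e i (inj₂ i≡2ℓ) (sym eq))
    embed-edge (inj₂ (e , i)) (inj₁ x) (inj₂ (_ , i≡0)) =
      crossing⇒edge T m _ _ (λ eq → end-edge x e i (inj₁ i≡0) (sym eq))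
    embed-edge (inj₂ (e , i)) (inj₂ (_ , j)) (inj₁ (refl , i+1≡j)) =
      crossing⇒edge T m _ _ (next-part e i j i+1≡j)
    embed-edge (inj₂ (e , i)) (inj₂ (_ , j)) (inj₂ (refl , j+1≡i)) =
      crossing⇒edge T m _ _ (λ eq → next-part e j i j+1≡i (sym eq))

  balloon-forcedBy-tree : Forces (Balloon T ℓ) T
  balloon-forcedBy-tree = Q , λ m Q≤m → embed m Q≤m , embed-injective m Q≤m , embed-edge m Q≤m

row col : ∀ k → Fin (k * k) → Fin k
row k z = proj₁ (Fin.remQuot {k} k z)
col k z = proj₂ (Fin.remQuot {k} k z)

row-col-injective : ∀ k {z z′ : Fin (k * k)} → row k z ≡ row k z′ → col k z ≡ col k z′ → z ≡ z′
row-col-injective k {z} {z′} r≡ c≡ = begin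
  z                                  ≡⟨ sym (Fin.combine-remQuot {k} k z) ⟩
  Fin.combine (row k z) (col k z)    ≡⟨ cong₂ Fin.combine r≡ c≡ ⟩
  Fin.combine (row k z′) (col k z′)  ≡⟨ Fin.combine-remQuot {k} k z′ ⟩
  z′                                 ∎
  where open ≡-Reasoning

row-combine : ∀ (i j : Fin k) → row k (Fin.combine i j) ≡ i
row-combine i j = cong proj₁ (Fin.remQuot-combine i j)

col-combine : ∀ (i j : Fin k) → col k (Fin.combine i j) ≡ j
col-combine i j = cong proj₂ (Fin.remQuot-combine i j)

edgeCodes : (G : Graph) → Subset (n G * n G)
edgeCodes G = tabulate λ z → adj G (row (n G) z) (col (n G) z)

combine-∈-edgeCodes : (G : Graph) {i j : Fin (n G)} → adj G i j ≡ true → Fin.combine i j ∈ edgeCodes G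
combine-∈-edgeCodes G {i} {j} ij =
  ∈-tabulate⁺ _ (subst (_≡ true) (sym (cong₂ (adj G) (row-combine i j) (col-combine i j))) ij)

∈-edgeCodes⇒adj : (G : Graph) {z : Fin (n G * n G)} → z ∈ edgeCodes G
                → adj G (row (n G) z) (col (n G) z) ≡ true
∈-edgeCodes⇒adj G = ∈-tabulate⁻ _

size : Graph → ℕ
size G = n G + ∣ edgeCodes G ∣

⊆ᴳ-refl : (G : RGraph) → G ⊆ᴳ G
⊆ᴳ-refl G = (λ x → x) , (λ eq → eq) , (λ _ _ xy → xy)

⊆ᴳ-trans : {F G H : RGraph} → F ⊆ᴳ G → G ⊆ᴳ H → F ⊆ᴳ H
⊆ᴳ-trans (f , f-inj , f-edge) (g , g-inj , g-edge) =
  g ∘ f , (λ eq → f-inj (g-inj eq)) , (λ x y xy → g-edge _ _ (f-edge x y xy))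

module _ (G H : Graph) (h : Fin (n G) → Fin (n H)) (h-injective : Injective _≡_ _≡_ h)
         (h-edge : ∀ x y → adj G x y ≡ true → adj H (h x) (h y) ≡ true) where

  private
    mapCode : (z : Fin (n G * n G)) → z ∈ edgeCodes G → Fin (n H * n H)
    mapCode z _ = Fin.combine (h (row (n G) z)) (h (col (n G) z))

    mapCode-∈ : ∀ z z∈ → mapCode z z∈ ∈ edgeCodes H
    mapCode-∈ z z∈ = combine-∈-edgeCodes H (h-edge _ _ (∈-edgeCodes⇒adj G z∈))

    mapCode-injective : ∀ {z z′} z∈ z′∈ → mapCode z z∈ ≡ mapCode z′ z′∈ → z ≡ z′
    mapCode-injective _ _ eq with Fin.combine-injective _ _ _ _ eq
    ... | r≡ , c≡ = row-col-injective (n G) (h-injective r≡) (h-injective c≡)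

  ∣edgeCodes∣-mono : ∣ edgeCodes G ∣ ≤ ∣ edgeCodes H ∣
  ∣edgeCodes∣-mono =
    injection⇒∣p∣≤∣q∣ (edgeCodes G) (edgeCodes H) mapCode mapCode-∈ mapCode-injective

  -- If the embedding h neither misses a vertex nor an edge of H, its inverse embeds H into G.
  size-strictMono : ¬ (toR H ⊆ᴳ toR G) → size G < size H
  size-strictMono H⊈G with size G ℕ.<? size H
  ... | yes G<H = G<H
  ... | no G≮H = contradiction (g , (λ {y} {y′} → g-injective {y} {y′}) , g-edge) H⊈G
    where
    preimage : ∀ y → Σ (Fin (n G)) λ x → h x ≡ y
    preimage y with Fin.any? (λ x → h x Fin.≟ y)
    ... | yes hit = hit
    ... | no miss = contradiction (ℕ.+-mono-<-≤ vertex< ∣edgeCodes∣-mono) G≮H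
      where
      vertex< : n G < n H
      vertex< = injective-nonSurjective⇒< h h-injective y λ x eq → miss (x , eq)

    g : Fin (n H) → Fin (n G)
    g y = proj₁ (preimage y)

    h∘g : ∀ y → h (g y) ≡ y
    h∘g y = proj₂ (preimage y)

    g-injective : Injective _≡_ _≡_ g
    g-injective {y} {y′} eq = trans (sym (h∘g y)) (trans (cong h eq) (h∘g y′))

    g-edge : ∀ y y′ → adj H y y′ ≡ true → adj G (g y) (g y′) ≡ true
    g-edge y y′ yy′ with adj G (g y) (g y′) in gyy′
    ... | true = refl
    ... | false = contradiction (ℕ.+-mono-≤-< (Fin.injective⇒≤ h-injective) edge<) G≮H
      where
      missed : ∀ z z∈ → mapCode z z∈ ≢ Fin.combine y y′
      missed z z∈ eq with Fin.combine-injective _ _ _ _ eq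
      ... | r≡ , c≡ = contradiction (trans (sym (∈-edgeCodes⇒adj G z∈)) (trans (cong₂ (adj G) row≡ col≡) gyy′)) λ ()
        where
        row≡ : row (n G) z ≡ g y
        row≡ = h-injective (trans r≡ (sym (h∘g y)))

        col≡ : col (n G) z ≡ g y′
        col≡ = h-injective (trans c≡ (sym (h∘g y′)))

      edge< : ∣ edgeCodes G ∣ < ∣ edgeCodes H ∣
      edge< = nonSurjective-injection⇒∣p∣<∣q∣ (edgeCodes G) (edgeCodes H) mapCode mapCode-∈ mapCode-injective
                (Fin.combine y y′) (combine-∈-edgeCodes H yy′) missed

-- Constructively we only get a minimal forcing subgraph up to double negation: a challenge to the
-- minimality of M₀ is answered by recursing on the smaller graph with the same continuation.
minimalForcing : (H : RGraph) (M₀ : Graph) → Forces H M₀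
               → ¬ ¬ (Σ Graph λ M → InDecomp H M × toR M ⊆ᴳ toR M₀)
minimalForcing H M₀ = go M₀ (<-wellFounded (size M₀))
  where
  go : ∀ M₀ → Acc _<_ (size M₀) → Forces H M₀
     → ¬ ¬ (Σ Graph λ M → InDecomp H M × toR M ⊆ᴳ toR M₀)
  go M₀ (acc smaller) M₀-forces found = found (M₀ , (M₀-forces , minimal) , ⊆ᴳ-refl (toR M₀))
    where
    minimal : ∀ M′ → toR M′ ⊆ᴳ toR M₀ → ¬ (toR M₀ ⊆ᴳ toR M′) → ¬ Forces H M′
    minimal M′ M′⊆M₀@(h , h-injective , h-edge) M₀⊈M′ M′-forces =
      go M′ (smaller (size-strictMono M′ M₀ h h-injective h-edge M₀⊈M′)) M′-forces
        λ (M , M∈ , M⊆M′) → found (M , M∈ , ⊆ᴳ-trans {toR M} {toR M′} {toR M₀} M⊆M′ M′⊆M₀)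

smallCovering⇒¬¬HasSmallCover : (T : Graph) (ℓ : Edge T → ℕ) (a : ℕ) (C : Subset (n T))
                              → Covering T C → ∣ C ∣ < a → ¬ ¬ HasSmallCover (Balloon T ℓ) a
smallCovering⇒¬¬HasSmallCover T ℓ a C C-covers ∣C∣<a =
  λ noSmall → minimalForcing (Balloon T ℓ) T (BalloonIntoTreeEmb.balloon-forcedBy-tree T ℓ)
    λ (M , M∈ , (h , h-injective , h-edge)) →
      noSmall (M , M∈ , preimage h , preimage-covers {M} h h-edge ,
               ℕ.≤-<-trans (∣preimage∣≤∣C∣ h h-injective) ∣C∣<a)
  where
  preimage : ∀ {k} → (Fin k → Fin (n T)) → Subset k
  preimage h = subsetOf λ i → h i ∈? C

  preimage-covers : ∀ {M : Graph} (h : Fin (n M) → Fin (n T))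
                  → (∀ x y → adj M x y ≡ true → adj T (h x) (h y) ≡ true) → Covering M (preimage h)
  preimage-covers h h-edge i j ij with C-covers (h i) (h j) (h-edge i j ij)
  ... | inj₁ hi∈C = inj₁ (∈-subsetOf⁺ (λ i → h i ∈? C) hi∈C)
  ... | inj₂ hj∈C = inj₂ (∈-subsetOf⁺ (λ i → h i ∈? C) hj∈C)

  ∣preimage∣≤∣C∣ : ∀ {k} (h : Fin k → Fin (n T)) → Injective _≡_ _≡_ h → ∣ preimage h ∣ ≤ ∣ C ∣
  ∣preimage∣≤∣C∣ h h-injective =
    injection⇒∣p∣≤∣q∣ (preimage h) C (λ i _ → h i) (λ i i∈ → ∈-subsetOf⁻ (λ i → h i ∈? C) i∈)
                      (λ _ _ → h-injective)

noSmallCover⇒coveringNumber≥ : (T : Graph) (ℓ : Edge T → ℕ) (a : ℕ)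
                             → ¬ HasSmallCover (Balloon T ℓ) a
                             → ∀ C → Covering T C → a ≤ ∣ C ∣
noSmallCover⇒coveringNumber≥ T ℓ a noSmall C C-covers with a ℕ.≤? ∣ C ∣
... | yes a≤∣C∣ = a≤∣C∣
... | no a≰∣C∣ = ⊥-elim (smallCovering⇒¬¬HasSmallCover T ℓ a C C-covers (ℕ.≰⇒> a≰∣C∣) noSmall)

module Paths (G : Graph) where

  record Path (u v : Fin (n G)) : Set where
    field
      len : ℕ
      at : ℕ → Fin (n G)
      at-0 : at 0 ≡ u
      at-len : at len ≡ v
      at-injective : ∀ {s t} → s ≤ len → t ≤ len → at s ≡ at t → s ≡ t
      at-adj : ∀ t → t < len → adj G (at t) (at (suc t)) ≡ true

  open Path public

  OnPath : ∀ {u v} → Path u v → Fin (n G) → Set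
  OnPath P w = Σ ℕ λ t → t ≤ len P × at P t ≡ w

  private
    variable
      u v w x : Fin (n G)

  edgePath : adj G u v ≡ true → u ≢ v → Path u v
  edgePath {u} {v} uv u≢v = record
    { len = 1 ; at = at′ ; at-0 = refl ; at-len = refl ; at-injective = injective
    ; at-adj = λ { zero _ → uv ; (suc _) (s≤s ()) } }
    where
    at′ : ℕ → Fin (n G)
    at′ zero = u
    at′ (suc _) = v

    injective : ∀ {s t} → s ≤ 1 → t ≤ 1 → at′ s ≡ at′ t → s ≡ t
    injective {zero} {zero} _ _ _ = refl
    injective {zero} {suc _} _ _ eq = contradiction eq u≢v
    injective {suc _} {zero} _ _ eq = contradiction (sym eq) u≢v
    injective {suc zero} {suc zero} _ _ _ = refl
    injective {suc (suc _)} (s≤s ()) _ _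
    injective {_} {suc (suc _)} _ (s≤s ()) _

  onEdgePath : (uv : adj G u v ≡ true) (u≢v : u ≢ v) → OnPath (edgePath uv u≢v) x → x ≡ u ⊎ x ≡ v
  onEdgePath _ _ (zero , _ , eq) = inj₁ (sym eq)
  onEdgePath _ _ (suc _ , _ , eq) = inj₂ (sym eq)

  prepend : (P : Path u v) → adj G w u ≡ true → ¬ OnPath P w → Path w v
  prepend {u} {v} {w} P wu w∉P = record
    { len = suc (len P) ; at = at′ ; at-0 = refl ; at-len = at-len P
    ; at-injective = injective ; at-adj = adj′ }
    where
    at′ : ℕ → Fin (n G)
    at′ zero = w
    at′ (suc t) = at P t

    injective : ∀ {s t} → s ≤ suc (len P) → t ≤ suc (len P) → at′ s ≡ at′ t → s ≡ t
    injective {zero} {zero} _ _ _ = refl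
    injective {zero} {suc t} _ t≤ eq = contradiction (t , ℕ.≤-pred t≤ , sym eq) w∉P
    injective {suc s} {zero} s≤ _ eq = contradiction (s , ℕ.≤-pred s≤ , eq) w∉P
    injective {suc s} {suc t} s≤ t≤ eq = cong suc (at-injective P (ℕ.≤-pred s≤) (ℕ.≤-pred t≤) eq)

    adj′ : ∀ t → t < suc (len P) → adj G (at′ t) (at′ (suc t)) ≡ true
    adj′ zero _ = subst (λ x → adj G w x ≡ true) (sym (at-0 P)) wu
    adj′ (suc t) t< = at-adj P t (ℕ.≤-pred t<)

  onPrepend : (P : Path u v) (wu : adj G w u ≡ true) (w∉P : ¬ OnPath P w)
            → OnPath (prepend P wu w∉P) x → x ≡ w ⊎ OnPath P x
  onPrepend _ _ _ (zero , _ , eq) = inj₁ (sym eq)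
  onPrepend _ _ _ (suc t , t≤ , eq) = inj₂ (t , ℕ.≤-pred t≤ , eq)

  append : (P : Path u v) → adj G v w ≡ true → ¬ OnPath P w → Path u w
  append {u} {v} {w} P vw w∉P = record
    { len = suc (len P) ; at = at′ ; at-0 = at′-0 ; at-len = at′-end
    ; at-injective = injective ; at-adj = adj′ }
    where
    at′ : ℕ → Fin (n G)
    at′ t with t ℕ.≤? len P
    ... | yes _ = at P t
    ... | no _ = w

    at′-0 : at′ 0 ≡ u
    at′-0 with 0 ℕ.≤? len P
    ... | yes _ = at-0 P
    ... | no 0≰ = contradiction z≤n 0≰

    at′-end : at′ (suc (len P)) ≡ w
    at′-end with suc (len P) ℕ.≤? len P
    ... | yes len<len = contradiction len<len (ℕ.<-irrefl refl)
    ... | no _ = refl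

    injective : ∀ {s t} → s ≤ suc (len P) → t ≤ suc (len P) → at′ s ≡ at′ t → s ≡ t
    injective {s} {t} s≤ t≤ eq with s ℕ.≤? len P | t ℕ.≤? len P
    ... | yes s≤len | yes t≤len = at-injective P s≤len t≤len eq
    ... | yes s≤len | no _ = contradiction (s , s≤len , eq) w∉P
    ... | no _ | yes t≤len = contradiction (t , t≤len , sym eq) w∉P
    ... | no s≰len | no t≰len =
      trans (ℕ.≤-antisym s≤ (ℕ.≰⇒> s≰len)) (sym (ℕ.≤-antisym t≤ (ℕ.≰⇒> t≰len)))

    adj′ : ∀ t → t < suc (len P) → adj G (at′ t) (at′ (suc t)) ≡ true
    adj′ t t< with t ℕ.≤? len P | suc t ℕ.≤? len P
    ... | yes _ | yes t<len = at-adj P t t<len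
    ... | yes t≤len | no t≮len =
      subst (λ x → adj G x w ≡ true)
            (trans (sym (at-len P)) (cong (at P) (ℕ.≤-antisym (ℕ.≮⇒≥ t≮len) t≤len))) vw
    ... | no t≰len | _ = contradiction (ℕ.≤-pred t<) t≰len

  onAppend : (P : Path u v) (vw : adj G v w ≡ true) (w∉P : ¬ OnPath P w)
           → OnPath (append P vw w∉P) x → x ≡ w ⊎ OnPath P x
  onAppend P _ _ (t , t≤ , eq) with t ℕ.≤? len P
  ... | yes t≤len = inj₂ (t , t≤len , eq)
  ... | no _ = inj₁ (sym eq)

  close : (P : Path u v) → 2 ≤ len P → adj G v u ≡ true → HasCycle G
  close P 2≤len vu = len P , 2≤len , (λ i → at P (toℕ i)) , injective , adj′ , closing
    where
    injective : Injective _≡_ _≡_ (λ i → at P (toℕ i))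
    injective {i} {j} eq =
      Fin.toℕ-injective (at-injective P (ℕ.≤-pred (Fin.toℕ<n i)) (ℕ.≤-pred (Fin.toℕ<n j)) eq)

    adj′ : ∀ i → adj G (at P (toℕ (Fin.inject₁ i))) (at P (toℕ (fsuc i))) ≡ true
    adj′ i rewrite Fin.toℕ-inject₁ i = at-adj P (toℕ i) (Fin.toℕ<n i)

    closing : adj G (at P (toℕ (Fin.fromℕ (len P)))) (at P 0) ≡ true
    closing rewrite Fin.toℕ-fromℕ (len P) | at-len P | at-0 P = vu

leastWitness : {P : ℕ → Set} → (∀ k → Dec (P k)) → ∀ N → P N
             → Σ ℕ λ k → P k × (∀ j → j < k → ¬ P j)
leastWitness {P} P? N = go N (<-wellFounded N)
  where
  go : ∀ N → Acc _<_ N → P N → Σ ℕ λ k → P k × (∀ j → j < k → ¬ P j)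
  go N (acc smaller) pN with Fin.any? {n = N} (λ j → P? (toℕ j))
  ... | yes (j , pj) = go (toℕ j) (smaller (Fin.toℕ<n j)) pj
  ... | no none = N , pN , λ j j<N pj → none (Fin.fromℕ< j<N , subst P (sym (Fin.toℕ-fromℕ< j<N)) pj)

two-elements : (p : Subset m) → 2 ≤ ∣ p ∣
             → Σ (Fin m) λ a → Σ (Fin m) λ b → a ∈ p × b ∈ p × a ≢ b
two-elements p 2≤∣p∣ = element p i₀ , element p i₁ , element-∈ p i₀ , element-∈ p i₁ ,
                       λ eq → i₀≢i₁ (element-injective p eq)
  where
  0<∣p∣ : 0 < ∣ p ∣
  0<∣p∣ = ℕ.≤-trans (s≤s z≤n) 2≤∣p∣

  i₀ i₁ : Fin ∣ p ∣
  i₀ = Fin.fromℕ< 0<∣p∣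
  i₁ = Fin.fromℕ< 2≤∣p∣

  i₀≢i₁ : i₀ ≢ i₁
  i₀≢i₁ eq with trans (sym (Fin.toℕ-fromℕ< 0<∣p∣)) (trans (cong toℕ eq) (Fin.toℕ-fromℕ< 2≤∣p∣))
  ... | ()

module RootedTree (T : Graph) (connected : Connected T) (acyclic : ¬ HasCycle T) (r : Fin (n T)) where

  open Paths T

  private
    variable
      u v x x′ y : Fin (n T)

  ReachIn : ℕ → Fin (n T) → Set
  ReachIn zero v = v ≡ r
  ReachIn (suc k) v = Σ (Fin (n T)) λ u → adj T u v ≡ true × ReachIn k u

  reachIn? : ∀ k v → Dec (ReachIn k v)
  reachIn? zero v = v Fin.≟ r
  reachIn? (suc k) v = Fin.any? λ u → (adj T u v ≟ᵇ true) ×-dec reachIn? k u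

  walk⇒reachIn : Walk T v r → ∃ λ k → ReachIn k v
  walk⇒reachIn here = 0 , refl
  walk⇒reachIn {v} (step {j = u} vu walk) with walk⇒reachIn walk
  ... | k , reach = suc k , u , trans (adj-sym T u v) vu , reach

  private
    depthWitness : ∀ v → Σ ℕ λ k → ReachIn k v × (∀ j → j < k → ¬ ReachIn j v)
    depthWitness v = leastWitness (λ k → reachIn? k v) _ (proj₂ (walk⇒reachIn (connected v r)))

  depth : Fin (n T) → ℕ
  depth v = proj₁ (depthWitness v)

  reachIn-depth : ∀ v → ReachIn (depth v) v
  reachIn-depth v = proj₁ (proj₂ (depthWitness v))

  depth-least : ∀ {k} → ReachIn k v → depth v ≤ k
  depth-least {v} reach = ℕ.≮⇒≥ λ k<d → proj₂ (proj₂ (depthWitness v)) _ k<d reach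

  depth-adj : adj T u v ≡ true → depth v ≤ suc (depth u)
  depth-adj {u} uv = depth-least (u , uv , reachIn-depth u)

  depth≡0 : depth v ≡ 0 → v ≡ r
  depth≡0 {v} d≡0 = subst (λ k → ReachIn k v) d≡0 (reachIn-depth v)

  parent : ∀ {k} → depth v ≡ suc k → Σ (Fin (n T)) λ u → adj T u v ≡ true × depth u ≡ k
  parent {v} d≡ with subst (λ k → ReachIn k v) d≡ (reachIn-depth v)
  ... | u , uv , reach =
    u , uv , ℕ.≤-antisym (depth-least reach) (ℕ.≤-pred (subst (_≤ suc (depth u)) d≡ (depth-adj uv)))

  below∉ : ∀ {D} (P : Path u v) → (∀ {w} → OnPath P w → suc D ≤ depth w)
         → depth x ≡ D → ¬ OnPath P x
  below∉ P deep dx x∈P = ℕ.<-irrefl (sym dx) (deep x∈P)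

  -- The parents of the two ends of P are one level up and off P; if they coincide they close P into a
  -- cycle, otherwise they extend P, and at depth 0 both ends would be the root.
  meet : ∀ D (P : Path u v) → depth u ≡ D → depth v ≡ D → 1 ≤ len P
       → (∀ {w} → OnPath P w → D ≤ depth w) → HasCycle T
  meet zero P du dv 1≤len _ =
    contradiction (at-injective P z≤n ℕ.≤-refl u≡v) (ℕ.<⇒≢ 1≤len)
    where
    u≡v : at P 0 ≡ at P (len P)
    u≡v = trans (at-0 P) (trans (depth≡0 du) (trans (sym (depth≡0 dv)) (sym (at-len P))))
  meet {u} {v} (suc D) P du dv 1≤len deep with parent du | parent dv
  ... | p , pu , dp | p′ , p′v , dp′ with p Fin.≟ p′
  ...   | yes refl = close (append P (trans (adj-sym T v p) p′v) (below∉ P deep dp)) (s≤s 1≤len) pu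
  ...   | no p≢p′ = meet D (prepend P′ pu p∉P′) dp dp′ (s≤s z≤n) deep′
    where
    vp′ : adj T v p′ ≡ true
    vp′ = trans (adj-sym T v p′) p′v

    P′ : Path u p′
    P′ = append P vp′ (below∉ P deep dp′)

    p∉P′ : ¬ OnPath P′ p
    p∉P′ p∈P′ with onAppend P vp′ (below∉ P deep dp′) p∈P′
    ... | inj₁ p≡p′ = p≢p′ p≡p′
    ... | inj₂ p∈P = below∉ P deep dp p∈P

    deep′ : ∀ {w} → OnPath (prepend P′ pu p∉P′) w → D ≤ depth w
    deep′ w∈ with onPrepend P′ pu p∉P′ w∈
    ... | inj₁ refl = ℕ.≤-reflexive (sym dp)
    ... | inj₂ w∈P′ with onAppend P vp′ (below∉ P deep dp′) w∈P′
    ...   | inj₁ refl = ℕ.≤-reflexive (sym dp′)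
    ...   | inj₂ w∈P = ℕ.≤-trans (ℕ.n≤1+n D) (deep w∈P)

  adj⇒depth≢ : adj T x y ≡ true → depth x ≢ depth y
  adj⇒depth≢ {x} {y} xy dx≡dy =
    acyclic (meet (depth x) (edgePath xy x≢y) refl (sym dx≡dy) (s≤s z≤n) deep)
    where
    x≢y : x ≢ y
    x≢y refl = contradiction (trans (sym xy) (adj-irrefl T x)) λ ()

    deep : ∀ {w} → OnPath (edgePath xy x≢y) w → depth x ≤ depth w
    deep w∈ with onEdgePath xy x≢y w∈
    ... | inj₁ refl = ℕ.≤-refl
    ... | inj₂ refl = ℕ.≤-reflexive dx≡dy

  adj⇒depth±1 : adj T x y ≡ true → suc (depth x) ≡ depth y ⊎ suc (depth y) ≡ depth x
  adj⇒depth±1 {x} {y} xy with ℕ.<-cmp (depth x) (depth y)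
  ... | tri< dx<dy _ _ = inj₁ (ℕ.≤-antisym dx<dy (depth-adj xy))
  ... | tri≈ _ dx≡dy _ = contradiction dx≡dy (adj⇒depth≢ xy)
  ... | tri> _ _ dy<dx = inj₂ (ℕ.≤-antisym dy<dx (depth-adj (trans (adj-sym T y x) xy)))

  parent-unique : adj T x y ≡ true → adj T x′ y ≡ true
                → suc (depth x) ≡ depth y → suc (depth x′) ≡ depth y → x ≡ x′
  parent-unique {x} {y} {x′} xy x′y dy dy′ with x Fin.≟ x′
  ... | yes x≡x′ = x≡x′
  ... | no x≢x′ = contradiction (meet (depth x) (prepend P xy x∉P) refl dx′ (s≤s z≤n) deep) acyclic
    where
    dx′ : depth x′ ≡ depth x
    dx′ = ℕ.suc-injective (trans dy′ (sym dy))

    below-y : ∀ {w} → suc (depth w) ≡ depth y → w ≢ y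
    below-y dw refl = ℕ.<-irrefl (sym dw) (ℕ.n<1+n _)

    yx′ : adj T y x′ ≡ true
    yx′ = trans (adj-sym T y x′) x′y

    y≢x′ : y ≢ x′
    y≢x′ y≡x′ = below-y dy′ (sym y≡x′)

    P : Path y x′
    P = edgePath yx′ y≢x′

    x∉P : ¬ OnPath P x
    x∉P x∈P with onEdgePath yx′ y≢x′ x∈P
    ... | inj₁ x≡y = below-y dy x≡y
    ... | inj₂ x≡x′ = x≢x′ x≡x′

    deep : ∀ {w} → OnPath (prepend P xy x∉P) w → depth x ≤ depth w
    deep w∈ with onPrepend P xy x∉P w∈
    ... | inj₁ refl = ℕ.≤-refl
    ... | inj₂ w∈P with onEdgePath yx′ y≢x′ w∈P
    ...   | inj₁ refl = ℕ.≤-trans (ℕ.n≤1+n _) (ℕ.≤-reflexive dy)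
    ...   | inj₂ refl = ℕ.≤-reflexive (sym dx′)

  child : 2 ≤ degree T x → Σ (Fin (n T)) λ y → adj T x y ≡ true × suc (depth x) ≡ depth y
  child {x} 2≤deg with two-elements (tabulate (adj T x)) 2≤deg
  ... | y₁ , y₂ , y₁∈ , y₂∈ , y₁≢y₂
    with ∈-tabulate⁻ (adj T x) y₁∈ | ∈-tabulate⁻ (adj T x) y₂∈
  ... | xy₁ | xy₂ with adj⇒depth±1 xy₁ | adj⇒depth±1 xy₂
  ...   | inj₁ d₁ | _ = y₁ , xy₁ , d₁
  ...   | inj₂ _ | inj₁ d₂ = y₂ , xy₂ , d₂
  ...   | inj₂ d₁ | inj₂ d₂ = contradiction
    (parent-unique (trans (adj-sym T y₁ x) xy₁) (trans (adj-sym T y₂ x) xy₂) d₁ d₂) y₁≢y₂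

  module _ (A : Subset (n T)) (bip : IsBipartition T A) (minDeg : MinDegAtLeast T A 2)
           (S : Subset (n T)) (S-covers : Covering T S) where

    private
      down : ∀ x → x ∈ A → Fin (n T)
      down x x∈A = proj₁ (child (minDeg x x∈A))

      down-adj : ∀ x x∈A → adj T x (down x x∈A) ≡ true
      down-adj x x∈A = proj₁ (proj₂ (child (minDeg x x∈A)))

      down-depth : ∀ x x∈A → suc (depth x) ≡ depth (down x x∈A)
      down-depth x x∈A = proj₂ (proj₂ (child (minDeg x x∈A)))

      down∉A : ∀ {x y} (x∈A : x ∈ A) (y∈A : y ∈ A) → x ≢ down y y∈A
      down∉A {x} {y} x∈A y∈A x≡down = bip y (down y y∈A) (down-adj y y∈A)
        (trans ([]=⇒lookup y∈A) (sym (trans (cong (lookup A) (sym x≡down)) ([]=⇒lookup x∈A))))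

    representative : ∀ x → x ∈ A → Dec (x ∈ S) → Fin (n T)
    representative x _ (yes _) = x
    representative x x∈A (no _) = down x x∈A

    representative-∈ : ∀ x x∈A x∈S? → representative x x∈A x∈S? ∈ S
    representative-∈ x x∈A (yes x∈S) = x∈S
    representative-∈ x x∈A (no x∉S) with S-covers x (down x x∈A) (down-adj x x∈A)
    ... | inj₁ x∈S = contradiction x∈S x∉S
    ... | inj₂ down∈S = down∈S

    representative-injective : ∀ {x y} x∈A y∈A x∈S? y∈S?
                             → representative x x∈A x∈S? ≡ representative y y∈A y∈S? → x ≡ y
    representative-injective _ _ (yes _) (yes _) eq = eq
    representative-injective x∈A y∈A (yes _) (no _) eq = contradiction eq (down∉A x∈A y∈A)
    representative-injective x∈A y∈A (no _) (yes _) eq = contradiction (sym eq) (down∉A y∈A x∈A)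
    representative-injective {x} {y} x∈A y∈A (no _) (no _) eq =
      parent-unique (down-adj x x∈A) (subst (λ z → adj T y z ≡ true) (sym eq) (down-adj y y∈A))
                    (down-depth x x∈A) (trans (down-depth y y∈A) (cong depth (sym eq)))

    minDeg≥2⇒∣A∣≤∣S∣ : ∣ A ∣ ≤ ∣ S ∣
    minDeg≥2⇒∣A∣≤∣S∣ = injection⇒∣p∣≤∣q∣ A S (λ x x∈A → representative x x∈A (x ∈? S))
                         (λ x x∈A → representative-∈ x x∈A (x ∈? S))
                         (λ x∈A y∈A → representative-injective x∈A y∈A (_ ∈? S) (_ ∈? S))

lemma5 : (T : Graph) → IsTree T → (A : Subset (n T)) → IsBipartition T A → ∣ A ∣ ≤ ∣ ∁ A ∣
         → (ℓ : Edge T → ℕ)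
         → (BIsKa (Balloon T ℓ) ∣ A ∣ ⇔ CoveringNumber T ∣ A ∣)
           × (MinDegAtLeast T A 2 → CoveringNumber T ∣ A ∣)
lemma5 T (1≤n , connected , acyclic) A bip _ ℓ = mk⇔ B≡K⇒β≡a β≡a⇒B≡K , minDeg⇒β≡a
  where
  B≡K⇔noSmall : BIsKa (Balloon T ℓ) ∣ A ∣ ⇔ (¬ HasSmallCover (Balloon T ℓ) ∣ A ∣)
  B≡K⇔noSmall = BIsKa⇔noSmallCover (Balloon T ℓ) ∣ A ∣

  A-covers : Covering T A
  A-covers = bipartition-covers T A bip

  B≡K⇒β≡a : BIsKa (Balloon T ℓ) ∣ A ∣ → CoveringNumber T ∣ A ∣
  B≡K⇒β≡a B≡K = (A , A-covers , refl) ,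
                 noSmallCover⇒coveringNumber≥ T ℓ ∣ A ∣ (Equivalence.to B≡K⇔noSmall B≡K)

  β≡a⇒B≡K : CoveringNumber T ∣ A ∣ → BIsKa (Balloon T ℓ) ∣ A ∣
  β≡a⇒B≡K (_ , β≥a) =
    Equivalence.from B≡K⇔noSmall (coveringNumber≥⇒noSmallCover T ℓ ∣ A ∣ β≥a)

  minDeg⇒β≡a : MinDegAtLeast T A 2 → CoveringNumber T ∣ A ∣
  minDeg⇒β≡a minDeg = (A , A-covers , refl) ,
    RootedTree.minDeg≥2⇒∣A∣≤∣S∣ T connected acyclic (Fin.fromℕ< 1≤n) A bip minDeg
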